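{- Let $n\ge2$, $\lambda$ a partition with at most $n-1$ non-zero parts, and $(w,T)\in\mathcal{A}(\lambda)$, with $T$ written as a concatenation of consecutive pieces $T=S_1S_2\cdots S_p$. Let $w_i:=wS_1\cdots S_i$ (so $w_0=w$). Then $$\tfrac12\big(\ell(w)+\ell(wT)-|T|\big)=\tfrac12\big(\ell(wS_1\cdots S_{p-1})+\ell(wT)-|S_p|\big)+\sum_{i=1}^{p-1}N(w_{i-1},S_i).$$
   Context: Permutations in one-line notation; $(a,b)$, $a<b$, a transposition; $wT:=wt_1\cdots t_s$ for $T=(t_1,\dots,t_s)$ (right multiplication by $(a,b)$ swaps the entries in positions $a,b$); $\ell$ = number of inversions; Bruhat order as usual; $|T|$ is the length of $T$. $\lambda'_j=\#\{i:\lambda_i\ge j\}$. For $1\le k\le n-1$, $\Gamma(k)=((1,n),(1,n-1),\dots,(1,k+1),(2,n),\dots,(2,k+1),\dots,(k,n),\dots,(k,k+1))$; $\Gamma=\Gamma(\lambda'_{\lambda_1})\cdots\Gamma(\lambda'_1)$. $S_n^\lambda$: minimal-length representatives of the cosets of the stabilizer of $\lambda\in\mathbb{Z}^n$ (under permutation of coordinates). $\mathcal{A}(\lambda)$ is the set of $(w,T)$ with $w\in S_n^\lambda$, $T=(t_1,\dots,t_s)$ a subsequence of $\Gamma$ and $w>wt_1>\dots>wt_1\cdots t_s$ strictly in Bruhat order. For a sequence $u$ of integers, $u[i,j]=u(i)u(i+1)\cdots u(j)$, and $N_{cd}(u)$ is the number of entries $e$ of $u$ with $c<e<d$. For a permutation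 $v$ and a sequence of transpositions $S=((a_1,b_1),\dots,(a_p,b_p))$, $a_i<b_i$, set $v_i=v(a_1,b_1)\cdots(a_i,b_i)$, $c_i=\min(v_i(a_i),v_i(b_i))$, $d_i=\max(v_i(a_i),v_i(b_i))$ and $N(v,S)=\sum_{i=1}^pN_{c_id_i}(v_i[a_i,b_i])$. -}

module Defs where

open import Data.Nat using (ℕ; zero; suc; _+_; _*_; _∸_; _≤_; _<_; _⊔_; _⊓_; _≟_; _<?_; _≤?_)
open import Data.List using (List; []; _∷_; map; concat; length; filter; reverse; upTo; foldr; _++_)
open import Data.List.Relation.Binary.Permutation.Propositional using (_↭_)
open import Data.List.Relation.Binary.Sublist.Propositional using (_⊆_)
open import Data.List.Relation.Unary.Linked using (Linked)
open import Data.Product using (_×_; _,_; ∃; ∃-syntax)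
open import Data.Bool using (if_then_else_)
open import Data.Unit using (⊤)
open import Relation.Nullary using (does; ¬_)
open import Relation.Nullary.Decidable using (_×-dec_)
open import Relation.Binary.PropositionalEquality using (_≡_)
open import Relation.Binary.Construct.Closure.ReflexiveTransitive using (Star)

-- Permutations of {1..n} in one-line notation, as lists of naturals.

-- 1-indexed access: at u i = u(i)  (0 outside the range, never used there)
at : List ℕ → ℕ → ℕ
at []       _             = 0
at (x ∷ xs) zero          = 0
at (x ∷ xs) (suc zero)    = x
at (x ∷ xs) (suc (suc i)) = at xs (suc i)

oneTo : ℕ → List ℕ
oneTo n = map suc (upTo n)

IsPerm : ℕ → List ℕ → Set
IsPerm n w = w ↭ oneTo n

-- A transposition (a,b), a < b, is stored as the pair (a , b).
Transp : Set
Transp = ℕ × ℕ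

tr : ℕ → ℕ → ℕ → ℕ
tr a b i = if does (i ≟ a) then b else (if does (i ≟ b) then a else i)

-- right multiplication  w ↦ w (a,b): swaps the entries in positions a and b
_·t_ : List ℕ → Transp → List ℕ
w ·t (a , b) = map (λ i → at w (tr a b i)) (oneTo (length w))

_·_ : List ℕ → List Transp → List ℕ
w · []       = w
w · (t ∷ ts) = (w ·t t) · ts

_∘p_ : List ℕ → List ℕ → List ℕ
w ∘p σ = map (at w) σ

ℓ : List ℕ → ℕ
ℓ []       = 0
ℓ (x ∷ xs) = length (filter (_<? x) xs) + ℓ xs

BruhatStep : List ℕ → List ℕ → Set
BruhatStep u v = ∃[ a ] ∃[ b ] (1 ≤ a × a < b × b ≤ length u × v ≡ u ·t (a , b) × ℓ u < ℓ v)

_≤B_ : List ℕ → List ℕ → Set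
u ≤B v = Star BruhatStep u v

_<B_ : List ℕ → List ℕ → Set
u <B v = u ≤B v × ¬ (u ≡ v)

-- lam ∈ ℤ^n a partition with at most n-1 nonzero parts: n entries, all ≥ 0,
-- weakly decreasing, and the last entry λ_n = 0.
IsPartition≤ : ℕ → List ℕ → Set
IsPartition≤ n lam = length lam ≡ n × Linked (λ x y → y ≤ x) lam × at lam n ≡ 0

conj : List ℕ → ℕ → ℕ
conj lam j = length (filter (j ≤?_) lam)

part1 : List ℕ → ℕ
part1 lam = foldr _⊔_ 0 lam

-- Γ(k) = ((1,n),(1,n-1),...,(1,k+1),(2,n),...,(2,k+1),...,(k,n),...,(k,k+1))
Γk : ℕ → ℕ → List Transp
Γk n k = concat (map (λ a → map (λ b → (a , b)) (reverse (map (λ i → k + suc i) (upTo (n ∸ k))))) (oneTo k))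

-- Γ = Γ(λ'_{λ_1}) ... Γ(λ'_1)
Γ : ℕ → List ℕ → List Transp
Γ n lam = concat (map (λ j → Γk n (conj lam j)) (reverse (oneTo (part1 lam))))

-- S_n^lam : minimal-length representatives of the cosets w W_λ, where
-- W_λ = stabilizer of lam under permutation of coordinates.

InStab : ℕ → List ℕ → List ℕ → Set
InStab n lam σ = IsPerm n σ × (∀ i → 1 ≤ i → i ≤ n → at lam (at σ i) ≡ at lam i)

InSλ : ℕ → List ℕ → List ℕ → Set
InSλ n lam w = IsPerm n w × (∀ σ → InStab n lam σ → ℓ w ≤ ℓ (w ∘p σ))

DecChain : List ℕ → List Transp → Set
DecChain u []       = ⊤
DecChain u (t ∷ ts) = (u ·t t) <B u × DecChain (u ·t t) ts

In𝒜 : ℕ → List ℕ → List ℕ → List Transp → Set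
In𝒜 n lam w T = InSλ n lam w × T ⊆ Γ n lam × DecChain w T

slice : List ℕ → ℕ → ℕ → List ℕ
slice u i j = map (λ k → at u (i + k)) (upTo (suc j ∸ i))

Ncd : ℕ → ℕ → List ℕ → ℕ
Ncd c d u = length (filter (λ e → (c <? e) ×-dec (e <? d)) u)

N : List ℕ → List Transp → ℕ
N v []            = 0
N v ((a , b) ∷ S) =
  let v' = v ·t (a , b)
      x  = at v' a
      y  = at v' b
  in Ncd (x ⊓ y) (x ⊔ y) (slice v' a b) + N v' S

sumN : List ℕ → List (List Transp) → ℕ
sumN w []       = 0
sumN w (S ∷ Ss) = N w S + sumN (w · S) Ss

module Submission where

-- The identity is a consequence of a formula for a single Bruhat descent.
-- Write a permutation as v = P x Q y R with x in position a and y in position b.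
-- Right multiplication by (a,b) gives v(a,b) = P y Q x R and, if y < x,
--   ℓ(v) = ℓ(v(a,b)) + 1 + 2·N_{yx}(Q)                                      (*)
-- because an entry of Q loses two inversions exactly when it lies strictly
-- between y and x, and the pair {x,y} itself loses one.  If ℓ(v(a,b)) < ℓ(v)
-- then necessarily y < x, and N_{yx}(Q) is the term N_{cd}(v₁[a,b]) of N.
-- Summing (*) along a chain v > vt₁ > vt₁t₂ > ⋯ gives
--   ℓ(v) = ℓ(vS) + |S| + 2·N(v,S).
-- For (w,T) ∈ 𝒜(λ) the transpositions of T come from Γ, hence satisfy
-- 1 ≤ a < b ≤ n, and the prefix S₁⋯S_{p-1} of T is again such a chain; as N is
-- additive under concatenation, N(w, S₁⋯S_{p-1}) = Σᵢ N(w_{i-1}, Sᵢ), and the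
-- theorem is integer arithmetic.

open import Defs
open import Data.Nat using (ℕ; _≤_)
open import Data.List using (List; []; _∷_; concat; length; _++_)
open import Data.List.Relation.Unary.All using (All)
open import Data.Product using (_×_)
open import Relation.Nullary using (¬_)
open import Relation.Binary.PropositionalEquality using (_≡_)

module Inversions where
  open import Data.Nat
    using (zero; suc; _+_; _*_; _∸_; _<_; _⊓_; _⊔_; _≟_; _<?_; _≤?_; z≤n; s≤s)
  open import Data.Nat.Properties
  open import Data.Nat.Tactic.RingSolver using (solve-∀)
  open import Data.List
    using (map; filter; upTo; applyUpTo; reverse; [_])
  open import Data.List.Properties
    using (length-++; filter-++; map-applyUpTo; map-upTo; ++-assoc; length-map; length-upTo)
  open import Data.List.Membership.Propositional using (_∉_)
  open import Data.List.Membership.Propositional.Properties using (∈-++⁺ˡ; ∈-++⁺ʳ; ∈-upTo⁻)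
  open import Data.List.Relation.Unary.Any using (here; there)
  open import Data.List.Relation.Unary.All using ([]; _∷_; tabulate; universal)
  open import Data.List.Relation.Unary.All.Properties using (++⁻ˡ; concat⁺; map⁺)
  open import Data.List.Relation.Unary.Unique.Propositional using (Unique)
  open import Data.List.Relation.Unary.Unique.Propositional.Properties
    using (upTo⁺; Unique[x∷xs]⇒x∉xs)
    renaming (map⁺ to Unique-map⁺)
  open import Data.List.Relation.Binary.Permutation.Propositional
    using (_↭_; prep; swap; ↭-refl; ↭-sym; ↭-trans; ↭⇒↭ₛ)
  open import Data.List.Relation.Binary.Permutation.Propositional.Properties
    using (shift; ++⁺ˡ; ↭-length; ↭-reverse; All-resp-↭)
  open import Relation.Binary.PropositionalEquality.Properties using (setoid)
  open import Data.List.Relation.Binary.Permutation.Setoid.Properties (setoid ℕ)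
    using (Unique-resp-↭; filter⁺; xs↭ys⇒|xs|≡|ys|)
  open import Data.List.Relation.Binary.Sublist.Propositional.Properties using (All-resp-⊆)
  open import Data.Product using (_,_; ∃-syntax)
  open import Data.Sum using (_⊎_; inj₁; inj₂)
  open import Data.Empty using (⊥-elim)
  open import Function using (_∘_)
  open import Relation.Nullary using (yes; no)
  open import Relation.Nullary.Decidable using (dec-true; dec-false; _×-dec_)
  open import Relation.Unary using (Decidable)
  open import Relation.Binary.Definitions using (tri<; tri≈; tri>)
  open import Relation.Binary.PropositionalEquality
    using (_≢_; refl; sym; trans; cong; cong₂; subst; module ≡-Reasoning)
  open import Relation.Binary.Construct.Closure.ReflexiveTransitive using (ε; _◅_)

  -- Positions in one-line notation.

  tr-left : ∀ a b → tr a b a ≡ b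
  tr-left a b rewrite dec-true (a ≟ a) refl = refl

  tr-right : ∀ a b → a ≢ b → tr a b b ≡ a
  tr-right a b a≢b rewrite dec-false (b ≟ a) (a≢b ∘ sym) | dec-true (b ≟ b) refl = refl

  tr-other : ∀ a b j → j ≢ a → j ≢ b → tr a b j ≡ j
  tr-other a b j j≢a j≢b rewrite dec-false (j ≟ a) j≢a | dec-false (j ≟ b) j≢b = refl

  at-mid : ∀ P (z : ℕ) R → at (P ++ z ∷ R) (suc (length P)) ≡ z
  at-mid []      z R = refl
  at-mid (_ ∷ P) z R = at-mid P z R

  at-skip : ∀ P L k → at (P ++ L) (suc (length P + k)) ≡ at L (suc k)
  at-skip []      L k = refl
  at-skip (_ ∷ P) L k = at-skip P L k

  at-++ˡ : ∀ L R k → k < length L → at (L ++ R) (suc k) ≡ at L (suc k)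
  at-++ˡ (_ ∷ L) R zero    _         = refl
  at-++ˡ (_ ∷ L) R (suc k) (s≤s k<L) = at-++ˡ L R k k<L

  at-other : ∀ P (z z′ : ℕ) R j → j ≢ suc (length P) → at (P ++ z ∷ R) j ≡ at (P ++ z′ ∷ R) j
  at-other []      z z′ R zero          _  = refl
  at-other []      z z′ R (suc zero)    ne = ⊥-elim (ne refl)
  at-other []      z z′ R (suc (suc j)) _  = refl
  at-other (_ ∷ P) z z′ R zero          _  = refl
  at-other (_ ∷ P) z z′ R (suc zero)    _  = refl
  at-other (_ ∷ P) z z′ R (suc (suc j)) ne = at-other P z z′ R (suc j) (ne ∘ cong suc)

  tabulate-at : ∀ (g : ℕ → ℕ) u → (∀ k → k < length u → g k ≡ at u (suc k)) →
    applyUpTo g (length u) ≡ u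
  tabulate-at g []      _ = refl
  tabulate-at g (z ∷ u) h =
    cong₂ _∷_ (h 0 (s≤s z≤n)) (tabulate-at (g ∘ suc) u (λ k k<u → h (suc k) (s≤s k<u)))

  ·t-pointwise : ∀ v a b u → length v ≡ length u →
    (∀ j → at v (tr a b j) ≡ at u j) → v ·t (a , b) ≡ u
  ·t-pointwise v a b u len agree = begin
      map (λ j → at v (tr a b j)) (map suc (upTo (length v)))
    ≡⟨ cong (map _) (map-upTo suc (length v)) ⟩
      map (λ j → at v (tr a b j)) (applyUpTo suc (length v))
    ≡⟨ map-applyUpTo suc _ (length v) ⟩
      applyUpTo (λ k → at v (tr a b (suc k))) (length v)
    ≡⟨ cong (applyUpTo _) len ⟩
      applyUpTo (λ k → at v (tr a b (suc k))) (length u)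
    ≡⟨ tabulate-at _ u (λ k _ → agree (suc k)) ⟩
      u
    ∎
    where open ≡-Reasoning

  -- The positions of x and y in  P ++ x ∷ Q ++ y ∷ R.
  left : List ℕ → ℕ
  left P = suc (length P)

  right : List ℕ → List ℕ → ℕ
  right P Q = suc (length P + suc (length Q))

  left≢right : ∀ P Q → left P ≢ right P Q
  left≢right P Q eq = m≢1+m+n (left P) (trans eq (cong suc (+-suc (length P) (length Q))))

  right≡ : ∀ P (x : ℕ) Q → suc (length (P ++ x ∷ Q)) ≡ right P Q
  right≡ P x Q = cong suc (length-++ P)

  at-right : ∀ P (x : ℕ) Q y R → at (P ++ x ∷ Q ++ y ∷ R) (right P Q) ≡ y
  at-right P x Q y R = trans (at-skip P (x ∷ Q ++ y ∷ R) (suc (length Q))) (at-mid Q y R)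

  at-other-right : ∀ P (x : ℕ) Q (y y′ : ℕ) R j → j ≢ right P Q →
    at (P ++ x ∷ Q ++ y ∷ R) j ≡ at (P ++ x ∷ Q ++ y′ ∷ R) j
  at-other-right P x Q y y′ R j j≢ = begin
      at (P ++ x ∷ Q ++ y ∷ R) j
    ≡⟨ cong (λ u → at u j) (sym (++-assoc P (x ∷ Q) (y ∷ R))) ⟩
      at ((P ++ x ∷ Q) ++ y ∷ R) j
    ≡⟨ at-other (P ++ x ∷ Q) y y′ R j (λ eq → j≢ (trans eq (right≡ P x Q))) ⟩
      at ((P ++ x ∷ Q) ++ y′ ∷ R) j
    ≡⟨ cong (λ u → at u j) (++-assoc P (x ∷ Q) (y′ ∷ R)) ⟩
      at (P ++ x ∷ Q ++ y′ ∷ R) j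
    ∎
    where open ≡-Reasoning

  swap-entries : ∀ P (x : ℕ) Q y R →
    (P ++ x ∷ Q ++ y ∷ R) ·t (left P , right P Q) ≡ P ++ y ∷ Q ++ x ∷ R
  swap-entries P x Q y R = ·t-pointwise v (left P) (right P Q) u same-length agree
    where
    v = P ++ x ∷ Q ++ y ∷ R
    u = P ++ y ∷ Q ++ x ∷ R
    same-length : length v ≡ length u
    same-length = trans (length-++ P)
      (trans (cong (λ m → length P + suc m) (trans (length-++ Q) (sym (length-++ Q))))
             (sym (length-++ P)))
    agree : ∀ j → at v (tr (left P) (right P Q) j) ≡ at u j
    agree j with j ≟ left P | j ≟ right P Q
    ... | yes refl | _ = begin
        at v (tr (left P) (right P Q) (left P)) ≡⟨ cong (at v) (tr-left (left P) (right P Q)) ⟩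
        at v (right P Q)                         ≡⟨ at-right P x Q y R ⟩
        y                                        ≡⟨ sym (at-mid P y (Q ++ x ∷ R)) ⟩
        at u (left P)                            ∎
      where open ≡-Reasoning
    ... | no _ | yes refl = begin
        at v (tr (left P) (right P Q) (right P Q)) ≡⟨ cong (at v) (tr-right (left P) (right P Q) (left≢right P Q)) ⟩
        at v (left P)                                ≡⟨ at-mid P x (Q ++ y ∷ R) ⟩
        x                                            ≡⟨ sym (at-right P y Q x R) ⟩
        at u (right P Q)                             ∎
      where open ≡-Reasoning
    ... | no j≢l | no j≢r = begin
        at v (tr (left P) (right P Q) j) ≡⟨ cong (at v) (tr-other (left P) (right P Q) j j≢l j≢r) ⟩
        at v j                             ≡⟨ at-other P x y (Q ++ y ∷ R) j j≢l ⟩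
        at (P ++ y ∷ Q ++ y ∷ R) j         ≡⟨ at-other-right P y Q y x R j j≢r ⟩
        at u j                             ∎
      where open ≡-Reasoning

  slice-window : ∀ P L R → slice (P ++ L ++ R) (left P) (length P + length L) ≡ L
  slice-window P L R = begin
      map (λ k → at (P ++ L ++ R) (left P + k)) (upTo (suc (length P + length L) ∸ left P))
    ≡⟨ cong (λ m → map (λ k → at (P ++ L ++ R) (left P + k)) (upTo m)) (m+n∸m≡n (length P) (length L)) ⟩
      map (λ k → at (P ++ L ++ R) (left P + k)) (upTo (length L))
    ≡⟨ map-upTo _ (length L) ⟩
      applyUpTo (λ k → at (P ++ L ++ R) (left P + k)) (length L)
    ≡⟨ tabulate-at _ L (λ k k<L → trans (at-skip P (L ++ R) k) (at-++ˡ L R k k<L)) ⟩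
      L
    ∎
    where open ≡-Reasoning

  split-at : ∀ (v : List ℕ) k → k < length v →
    ∃[ P ] ∃[ z ] ∃[ R ] (v ≡ P ++ z ∷ R × length P ≡ k)
  split-at (z ∷ v) zero    _         = [] , z , v , refl , refl
  split-at (u ∷ v) (suc k) (s≤s k<v) with split-at v k k<v
  ... | P , z , R , refl , refl = u ∷ P , z , R , refl , refl

  split-two : ∀ v a b → 1 ≤ a → a < b → b ≤ length v →
    ∃[ P ] ∃[ x ] ∃[ Q ] ∃[ y ] ∃[ R ]
      (v ≡ P ++ x ∷ Q ++ y ∷ R × left P ≡ a × right P Q ≡ b)
  split-two v (suc p) b _ a<b b≤v with split-at v p (≤-trans (n≤1+n (suc p)) (≤-trans a<b b≤v))
  ... | P , x , Rest , refl , refl with m≤n⇒∃[o]m+o≡n a<b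
  ...   | o , refl with split-at Rest o o<Rest
    where
    o<Rest : o < length Rest
    o<Rest = +-cancelˡ-< (length P) o (length Rest) (≤-pred (≤-trans b≤v
      (≤-reflexive (trans (length-++ P) (+-suc (length P) (length Rest))))))
  ...     | Q , y , R , refl , refl =
    P , x , Q , y , R , refl , refl , cong suc (+-suc (length P) (length Q))

  -- Inversions of concatenations.

  below : ℕ → List ℕ → ℕ
  below z L = length (filter (_<? z) L)

  length-filter-++ : ∀ {P : ℕ → Set} (P? : Decidable P) A B →
    length (filter P? (A ++ B)) ≡ length (filter P? A) + length (filter P? B)
  length-filter-++ P? A B = trans (cong length (filter-++ P? A B)) (length-++ (filter P? A))

  below-++ : ∀ z A B → below z (A ++ B) ≡ below z A + below z B
  below-++ z = length-filter-++ (_<? z)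

  below-resp-↭ : ∀ z {A B} → A ↭ B → below z A ≡ below z B
  below-resp-↭ z A↭B = xs↭ys⇒|xs|≡|ys| (filter⁺ (_<? z) (subst (_< z)) (↭⇒↭ₛ A↭B))

  cross : List ℕ → List ℕ → ℕ
  cross []      B = 0
  cross (z ∷ A) B = below z B + cross A B

  ℓ-++ : ∀ A B → ℓ (A ++ B) ≡ ℓ A + ℓ B + cross A B
  ℓ-++ []      B = sym (+-identityʳ (ℓ B))
  ℓ-++ (z ∷ A) B rewrite below-++ z A B | ℓ-++ A B =
    shuffle (below z A) (below z B) (ℓ A) (ℓ B) (cross A B)
    where
    shuffle : ∀ a b c d e → a + b + (c + d + e) ≡ a + c + d + (b + e)
    shuffle = solve-∀

  cross-++ʳ : ∀ A B C → cross A (B ++ C) ≡ cross A B + cross A C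
  cross-++ʳ []      B C = refl
  cross-++ʳ (z ∷ A) B C rewrite below-++ z B C | cross-++ʳ A B C =
    shuffle (below z B) (below z C) (cross A B) (cross A C)
    where
    shuffle : ∀ a b c d → a + b + (c + d) ≡ a + c + (b + d)
    shuffle = solve-∀

  cross-resp-↭ : ∀ A {B C} → B ↭ C → cross A B ≡ cross A C
  cross-resp-↭ []      _   = refl
  cross-resp-↭ (z ∷ A) B↭C = cong₂ _+_ (below-resp-↭ z B↭C) (cross-resp-↭ A B↭C)

  exchange-↭ : ∀ P (x y : ℕ) Q R → P ++ y ∷ Q ++ x ∷ R ↭ P ++ x ∷ Q ++ y ∷ R
  exchange-↭ P x y Q R = ++⁺ˡ P
    (↭-trans (prep y (shift x Q R)) (↭-trans (swap y x ↭-refl) (prep x (↭-sym (shift y Q R)))))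

  -- The transposition formula (*).

  below-one : ∀ {q z} → q < z → below z [ q ] ≡ 1
  below-one {q} {z} q<z rewrite dec-true (q <? z) q<z = refl

  below-zero : ∀ {q z} → ¬ q < z → below z [ q ] ≡ 0
  below-zero {q} {z} q≮z rewrite dec-false (q <? z) q≮z = refl

  between-one : ∀ {c d q} → c < q → q < d → Ncd c d [ q ] ≡ 1
  between-one {c} {d} {q} c<q q<d rewrite dec-true ((c <? q) ×-dec (q <? d)) (c<q , q<d) = refl

  between-zero : ∀ {c d q} → ¬ (c < q × q < d) → Ncd c d [ q ] ≡ 0
  between-zero {c} {d} {q} out rewrite dec-false ((c <? q) ×-dec (q <? d)) out = refl

  Ncd-++ : ∀ c d A B → Ncd c d (A ++ B) ≡ Ncd c d A + Ncd c d B
  Ncd-++ c d = length-filter-++ (λ e → (c <? e) ×-dec (e <? d))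

  between-single : ∀ x y q → y < x → q ≢ x → q ≢ y →
    below x [ q ] + below q [ y ] ≡ below y [ q ] + below q [ x ] + 2 * Ncd y x [ q ]
  between-single x y q y<x q≢x q≢y with <-cmp q y
  ... | tri≈ _ q≡y _ = ⊥-elim (q≢y q≡y)
  ... | tri< q<y _ _
    rewrite below-one (<-trans q<y y<x) | below-zero {y} {q} (<⇒≯ q<y) | below-one q<y
          | below-zero {x} {q} (<⇒≯ (<-trans q<y y<x))
          | between-zero {y} {x} {q} (λ (y<q , _) → <⇒≯ q<y y<q) = refl
  ... | tri> _ _ y<q with <-cmp q x
  ...   | tri≈ _ q≡x _ = ⊥-elim (q≢x q≡x)
  ...   | tri< q<x _ _
    rewrite below-one q<x | below-one y<q | below-zero {q} {y} (<⇒≯ y<q)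
          | below-zero {x} {q} (<⇒≯ q<x) | between-one y<q q<x = refl
  ...   | tri> _ _ x<q
    rewrite below-zero {q} {x} (<⇒≯ x<q) | below-one y<q | below-zero {q} {y} (<⇒≯ y<q)
          | below-one x<q | between-zero {y} {x} {q} (λ (_ , q<x) → <⇒≯ x<q q<x) = refl

  between-count : ∀ x y Q → y < x → x ∉ Q → y ∉ Q →
    below x Q + cross Q [ y ] ≡ below y Q + cross Q [ x ] + 2 * Ncd y x Q
  between-count x y []      _   _  _  = refl
  between-count x y (q ∷ Q) y<x x∉ y∉ = begin
      below x (q ∷ Q) + (below q [ y ] + cross Q [ y ])
    ≡⟨ cong (_+ (below q [ y ] + cross Q [ y ])) (below-++ x [ q ] Q) ⟩
      below x [ q ] + below x Q + (below q [ y ] + cross Q [ y ])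
    ≡⟨ regroup (below x [ q ]) (below x Q) (below q [ y ]) (cross Q [ y ]) ⟩
      (below x [ q ] + below q [ y ]) + (below x Q + cross Q [ y ])
    ≡⟨ cong₂ _+_ (between-single x y q y<x (x∉ ∘ here ∘ sym) (y∉ ∘ here ∘ sym))
                 (between-count x y Q y<x (x∉ ∘ there) (y∉ ∘ there)) ⟩
      (below y [ q ] + below q [ x ] + 2 * Ncd y x [ q ]) + (below y Q + cross Q [ x ] + 2 * Ncd y x Q)
    ≡⟨ collect (below y [ q ]) (below q [ x ]) (Ncd y x [ q ]) (below y Q) (cross Q [ x ]) (Ncd y x Q) ⟩
      below y [ q ] + below y Q + (below q [ x ] + cross Q [ x ]) + 2 * (Ncd y x [ q ] + Ncd y x Q)
    ≡⟨ sym (cong₂ (λ s t → s + (below q [ x ] + cross Q [ x ]) + 2 * t) (below-++ y [ q ] Q) (Ncd-++ y x [ q ] Q)) ⟩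
      below y (q ∷ Q) + (below q [ x ] + cross Q [ x ]) + 2 * Ncd y x (q ∷ Q)
    ∎
    where
    open ≡-Reasoning
    regroup : ∀ a b c d → a + b + (c + d) ≡ (a + c) + (b + d)
    regroup = solve-∀
    collect : ∀ a b c d e f → (a + b + 2 * c) + (d + e + 2 * f) ≡ a + d + (b + e) + 2 * (c + f)
    collect = solve-∀

  -- ℓ (x ∷ Q ++ y ∷ R), separated into the part involving x or y with Q, the
  -- pair (x,y), and a part symmetric in x and y.
  ℓ-two-marked : ∀ x y Q R → ℓ (x ∷ Q ++ y ∷ R) ≡
    (below x Q + cross Q [ y ]) + below x [ y ] + (below x R + below y R + ℓ Q + ℓ R + cross Q R)
  ℓ-two-marked x y Q R = begin
      below x (Q ++ y ∷ R) + ℓ (Q ++ y ∷ R)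
    ≡⟨ cong₂ _+_ (trans (below-++ x Q (y ∷ R)) (cong (below x Q +_) (below-++ x [ y ] R)))
                 (trans (ℓ-++ Q (y ∷ R)) (cong (ℓ Q + ℓ (y ∷ R) +_) (cross-++ʳ Q [ y ] R))) ⟩
      below x Q + (below x [ y ] + below x R) + (ℓ Q + (below y R + ℓ R) + (cross Q [ y ] + cross Q R))
    ≡⟨ regroup (below x Q) (below x [ y ]) (below x R) (ℓ Q) (below y R) (ℓ R) (cross Q [ y ]) (cross Q R) ⟩
      (below x Q + cross Q [ y ]) + below x [ y ] + (below x R + below y R + ℓ Q + ℓ R + cross Q R)
    ∎
    where
    open ≡-Reasoning
    regroup : ∀ a b c d e f g h →
      a + (b + c) + (d + (e + f) + (g + h)) ≡ (a + g) + b + (c + e + d + f + h)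
    regroup = solve-∀

  exchange-head : ∀ x y Q R → y < x → x ∉ Q → y ∉ Q →
    ℓ (x ∷ Q ++ y ∷ R) ≡ ℓ (y ∷ Q ++ x ∷ R) + 1 + 2 * Ncd y x Q
  exchange-head x y Q R y<x x∉Q y∉Q = begin
      ℓ (x ∷ Q ++ y ∷ R)
    ≡⟨ ℓ-two-marked x y Q R ⟩
      (below x Q + cross Q [ y ]) + below x [ y ] + (below x R + below y R + ℓ Q + ℓ R + cross Q R)
    ≡⟨ cong₂ (λ s t → s + t + (below x R + below y R + ℓ Q + ℓ R + cross Q R))
             (between-count x y Q y<x x∉Q y∉Q) (below-one y<x) ⟩
      (below y Q + cross Q [ x ] + 2 * Ncd y x Q) + 1 + (below x R + below y R + ℓ Q + ℓ R + cross Q R)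
    ≡⟨ regroup (below y Q + cross Q [ x ]) (2 * Ncd y x Q) (below x R) (below y R) (ℓ Q) (ℓ R) (cross Q R) ⟩
      (below y Q + cross Q [ x ]) + 0 + (below y R + below x R + ℓ Q + ℓ R + cross Q R) + 1 + 2 * Ncd y x Q
    ≡⟨ cong (λ t → (below y Q + cross Q [ x ]) + t + (below y R + below x R + ℓ Q + ℓ R + cross Q R) + 1 + 2 * Ncd y x Q)
            (sym (below-zero (<⇒≯ y<x))) ⟩
      (below y Q + cross Q [ x ]) + below y [ x ] + (below y R + below x R + ℓ Q + ℓ R + cross Q R) + 1 + 2 * Ncd y x Q
    ≡⟨ cong (λ t → t + 1 + 2 * Ncd y x Q) (sym (ℓ-two-marked y x Q R)) ⟩
      ℓ (y ∷ Q ++ x ∷ R) + 1 + 2 * Ncd y x Q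
    ∎
    where
    open ≡-Reasoning
    regroup : ∀ s n a b c d e → s + n + 1 + (a + b + c + d + e) ≡ s + 0 + (b + a + c + d + e) + 1 + n
    regroup = solve-∀

  exchange-length : ∀ P x y Q R → y < x → x ∉ Q → y ∉ Q →
    ℓ (P ++ x ∷ Q ++ y ∷ R) ≡ ℓ (P ++ y ∷ Q ++ x ∷ R) + 1 + 2 * Ncd y x Q
  exchange-length P x y Q R y<x x∉Q y∉Q = begin
      ℓ (P ++ x ∷ Q ++ y ∷ R)
    ≡⟨ ℓ-++ P (x ∷ Q ++ y ∷ R) ⟩
      ℓ P + ℓ (x ∷ Q ++ y ∷ R) + cross P (x ∷ Q ++ y ∷ R)
    ≡⟨ cong₂ (λ s t → ℓ P + s + t) (exchange-head x y Q R y<x x∉Q y∉Q)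
                                   (cross-resp-↭ P (↭-sym (exchange-↭ [] x y Q R))) ⟩
      ℓ P + (ℓ (y ∷ Q ++ x ∷ R) + 1 + 2 * Ncd y x Q) + cross P (y ∷ Q ++ x ∷ R)
    ≡⟨ regroup (ℓ P) (ℓ (y ∷ Q ++ x ∷ R)) (2 * Ncd y x Q) (cross P (y ∷ Q ++ x ∷ R)) ⟩
      ℓ P + ℓ (y ∷ Q ++ x ∷ R) + cross P (y ∷ Q ++ x ∷ R) + 1 + 2 * Ncd y x Q
    ≡⟨ cong (λ t → t + 1 + 2 * Ncd y x Q) (sym (ℓ-++ P (y ∷ Q ++ x ∷ R))) ⟩
      ℓ (P ++ y ∷ Q ++ x ∷ R) + 1 + 2 * Ncd y x Q
    ∎
    where
    open ≡-Reasoning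
    regroup : ∀ a b m c → a + (b + 1 + m) + c ≡ a + b + c + 1 + m
    regroup = solve-∀

  -- Descents of permutations.

  -- The summand N_{cd}(v′[a,b]) of N, where c < d are the entries of v′ in
  -- positions a and b; N v ((a , b) ∷ S) = Nswap (v ·t (a , b)) a b + ⋯.
  Nswap : List ℕ → ℕ → ℕ → ℕ
  Nswap v′ a b = Ncd (at v′ a ⊓ at v′ b) (at v′ a ⊔ at v′ b) (slice v′ a b)

  Ncd-endpoints : ∀ c d Q → c < d → Ncd c d (c ∷ Q ++ [ d ]) ≡ Ncd c d Q
  Ncd-endpoints c d Q c<d = begin
      Ncd c d ([ c ] ++ Q ++ [ d ])
    ≡⟨ Ncd-++ c d [ c ] (Q ++ [ d ]) ⟩
      Ncd c d [ c ] + Ncd c d (Q ++ [ d ])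
    ≡⟨ cong₂ _+_ (between-zero {c} {d} {c} (λ (c<c , _) → <-irrefl refl c<c)) (Ncd-++ c d Q [ d ]) ⟩
      Ncd c d Q + Ncd c d [ d ]
    ≡⟨ cong (Ncd c d Q +_) (between-zero {c} {d} {d} (λ (_ , d<d) → <-irrefl refl d<d)) ⟩
      Ncd c d Q + 0
    ≡⟨ +-identityʳ (Ncd c d Q) ⟩
      Ncd c d Q
    ∎
    where open ≡-Reasoning

  exchange-window : ∀ P (y : ℕ) Q x R →
    slice (P ++ y ∷ Q ++ x ∷ R) (left P) (right P Q) ≡ y ∷ Q ++ [ x ]
  exchange-window P y Q x R = begin
      slice (P ++ y ∷ Q ++ x ∷ R) (left P) (right P Q)
    ≡⟨ cong₂ (λ u b → slice u (left P) b) (cong (λ t → P ++ y ∷ t) (sym (++-assoc Q [ x ] R))) right-end ⟩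
      slice (P ++ (y ∷ Q ++ [ x ]) ++ R) (left P) (length P + length (y ∷ Q ++ [ x ]))
    ≡⟨ slice-window P (y ∷ Q ++ [ x ]) R ⟩
      y ∷ Q ++ [ x ]
    ∎
    where
    open ≡-Reasoning
    right-end : right P Q ≡ length P + length (y ∷ Q ++ [ x ])
    right-end = trans (cong (λ m → suc (length P + m)) (sym (trans (length-++ Q) (+-comm (length Q) 1))))
                      (sym (+-suc (length P) (length (Q ++ [ x ]))))

  Nswap-exchanged : ∀ P (x : ℕ) Q y R → y < x →
    Nswap (P ++ y ∷ Q ++ x ∷ R) (left P) (right P Q) ≡ Ncd y x Q
  Nswap-exchanged P x Q y R y<x = begin
      Ncd (at u (left P) ⊓ at u (right P Q)) (at u (left P) ⊔ at u (right P Q)) (slice u (left P) (right P Q))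
    ≡⟨ cong₂ (λ c d → Ncd (c ⊓ d) (c ⊔ d) (slice u (left P) (right P Q)))
             (at-mid P y (Q ++ x ∷ R)) (at-right P y Q x R) ⟩
      Ncd (y ⊓ x) (y ⊔ x) (slice u (left P) (right P Q))
    ≡⟨ cong₂ (λ c d → Ncd c d (slice u (left P) (right P Q)))
             (m≤n⇒m⊓n≡m (<⇒≤ y<x)) (m≤n⇒m⊔n≡n (<⇒≤ y<x)) ⟩
      Ncd y x (slice u (left P) (right P Q))
    ≡⟨ cong (Ncd y x) (exchange-window P y Q x R) ⟩
      Ncd y x (y ∷ Q ++ [ x ])
    ≡⟨ Ncd-endpoints y x Q y<x ⟩
      Ncd y x Q
    ∎
    where
    open ≡-Reasoning
    u = P ++ y ∷ Q ++ x ∷ R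

  Unique-split : ∀ P (z : ℕ) M → Unique (P ++ z ∷ M) → z ∉ P ++ M
  Unique-split P z M uniq = Unique[x∷xs]⇒x∉xs (Unique-resp-↭ (↭⇒↭ₛ (shift z P M)) uniq)

  distinct-marked : ∀ P (x : ℕ) Q y R → Unique (P ++ x ∷ Q ++ y ∷ R) → x ≢ y × x ∉ Q × y ∉ Q
  distinct-marked P x Q y R uniq =
    (λ x≡y → x∉ (∈-++⁺ʳ P (∈-++⁺ʳ Q (here x≡y)))) , x∉ ∘ ∈-++⁺ʳ P ∘ ∈-++⁺ˡ , y∉ ∘ ∈-++⁺ˡ ∘ ∈-++⁺ʳ P ∘ there
    where
    x∉ = Unique-split P x (Q ++ y ∷ R) uniq
    y∉ = Unique-split (P ++ x ∷ Q) y R (subst Unique (sym (++-assoc P (x ∷ Q) (y ∷ R))) uniq)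

  -- Formula (*) for a descent v > v(a,b) of a list v without repetitions:
  -- a descent must move the larger entry to the right.
  descent-length : ∀ v a b → Unique v → 1 ≤ a → a < b → b ≤ length v →
    ℓ (v ·t (a , b)) < ℓ v → ℓ v ≡ ℓ (v ·t (a , b)) + 1 + 2 * Nswap (v ·t (a , b)) a b
  descent-length v a b uniq 1≤a a<b b≤v descent with split-two v a b 1≤a a<b b≤v
  ... | P , x , Q , y , R , refl , refl , refl
    with distinct-marked P x Q y R uniq | <-cmp x y
  ...   | x≢y , _ , _ | tri≈ _ x≡y _ = ⊥-elim (x≢y x≡y)
  ...   | _ , x∉Q , y∉Q | tri< x<y _ _ =
    ⊥-elim (<⇒≱ descent (≤-trans (m≤m+n _ _) (≤-trans (m≤m+n _ _)
      (≤-reflexive (trans (sym (exchange-length P y x Q R x<y y∉Q x∉Q))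
        (cong ℓ (sym (swap-entries P x Q y R))))))))
  ...   | _ , x∉Q , y∉Q | tri> _ _ y<x
    rewrite swap-entries P x Q y R | Nswap-exchanged P x Q y R y<x = exchange-length P x y Q R y<x x∉Q y∉Q

  ·t-IsPerm : ∀ n v a b → IsPerm n v → 1 ≤ a → a < b → b ≤ length v → IsPerm n (v ·t (a , b))
  ·t-IsPerm n v a b perm 1≤a a<b b≤v with split-two v a b 1≤a a<b b≤v
  ... | P , x , Q , y , R , refl , refl , refl
    rewrite swap-entries P x Q y R = ↭-trans (exchange-↭ P x y Q R) perm

  IsPerm-length : ∀ n v → IsPerm n v → length v ≡ n
  IsPerm-length n v perm = trans (↭-length perm) (trans (length-map suc (upTo n)) (length-upTo n))

  IsPerm-Unique : ∀ n v → IsPerm n v → Unique v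
  IsPerm-Unique n v perm = Unique-resp-↭ (↭⇒↭ₛ (↭-sym perm)) (Unique-map⁺ suc-injective (upTo⁺ n))

  ≤B-ℓ : ∀ {u v} → u ≤B v → u ≡ v ⊎ ℓ u < ℓ v
  ≤B-ℓ ε = inj₁ refl
  ≤B-ℓ ((_ , _ , _ , _ , _ , _ , ℓu<) ◅ rest) with ≤B-ℓ rest
  ... | inj₁ refl = inj₂ ℓu<
  ... | inj₂ ℓ<   = inj₂ (<-trans ℓu< ℓ<)

  <B-ℓ : ∀ {u v} → u <B v → ℓ u < ℓ v
  <B-ℓ (u≤v , u≢v) with ≤B-ℓ u≤v
  ... | inj₁ u≡v = ⊥-elim (u≢v u≡v)
  ... | inj₂ ℓ<  = ℓ<

  -- Decreasing chains.

  Valid : ℕ → Transp → Set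
  Valid n (a , b) = 1 ≤ a × a < b × b ≤ n

  chain-length : ∀ n v S → IsPerm n v → All (Valid n) S → DecChain v S →
    ℓ v ≡ ℓ (v · S) + length S + 2 * N v S
  chain-length n v []            _    _                          _ =
    sym (trans (+-identityʳ _) (+-identityʳ (ℓ v)))
  chain-length n v ((a , b) ∷ S) perm ((1≤a , a<b , b≤n) ∷ valid) (descent , chain) = begin
      ℓ v
    ≡⟨ descent-length v a b (IsPerm-Unique n v perm) 1≤a a<b b≤v (<B-ℓ descent) ⟩
      ℓ v′ + 1 + 2 * Nswap v′ a b
    ≡⟨ cong (λ t → t + 1 + 2 * Nswap v′ a b)
            (chain-length n v′ S (·t-IsPerm n v a b perm 1≤a a<b b≤v) valid chain) ⟩
      ℓ (v′ · S) + length S + 2 * N v′ S + 1 + 2 * Nswap v′ a b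
    ≡⟨ regroup (ℓ (v′ · S)) (length S) (N v′ S) (Nswap v′ a b) ⟩
      ℓ (v′ · S) + suc (length S) + 2 * (Nswap v′ a b + N v′ S)
    ∎
    where
    open ≡-Reasoning
    v′ = v ·t (a , b)
    b≤v = subst (b ≤_) (sym (IsPerm-length n v perm)) b≤n
    regroup : ∀ l s m k → l + s + 2 * m + 1 + 2 * k ≡ l + suc s + 2 * (k + m)
    regroup = solve-∀

  N-++ : ∀ v S S′ → N v (S ++ S′) ≡ N v S + N (v · S) S′
  N-++ v []            S′ = refl
  N-++ v ((a , b) ∷ S) S′ rewrite N-++ (v ·t (a , b)) S S′ = sym (+-assoc (Nswap (v ·t (a , b)) a b) _ _)

  sumN≡N-concat : ∀ w Ss → sumN w Ss ≡ N w (concat Ss)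
  sumN≡N-concat w []       = refl
  sumN≡N-concat w (S ∷ Ss) rewrite N-++ w S (concat Ss) | sumN≡N-concat (w · S) Ss = refl

  DecChain-prefix : ∀ v S S′ → DecChain v (S ++ S′) → DecChain v S
  DecChain-prefix v []      S′ _               = _
  DecChain-prefix v (t ∷ S) S′ (descent , chain) = descent , DecChain-prefix (v ·t t) S S′ chain

  -- The λ-chain Γ.

  Γk-entry-valid : ∀ n k i j → i < k → j < n ∸ k → Valid n (suc i , k + suc j)
  Γk-entry-valid n k i j i<k j<n-k with k ≤? n
  ... | yes k≤n = s≤s z≤n
                , ≤-trans (s≤s i<k) (≤-trans (s≤s (m≤m+n k j)) (≤-reflexive (sym (+-suc k j))))
                , ≤-trans (+-monoʳ-≤ k j<n-k) (≤-reflexive (m+[n∸m]≡n k≤n))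
  ... | no k≰n = ⊥-elim (n≮0 (subst (j <_) (m≤n⇒m∸n≡0 (<⇒≤ (≰⇒> k≰n))) j<n-k))

  Γk-valid : ∀ n k → All (Valid n) (Γk n k)
  Γk-valid n k = concat⁺ (map⁺ (map⁺ (tabulate λ {i} i∈ →
    map⁺ (All-resp-↭ (↭-sym (↭-reverse _)) (map⁺ (tabulate λ {j} j∈ →
      Γk-entry-valid n k i j (∈-upTo⁻ i∈) (∈-upTo⁻ j∈)))))))

  Γ-valid : ∀ n lam → All (Valid n) (Γ n lam)
  Γ-valid n lam = concat⁺ (map⁺ (universal (λ j → Γk-valid n (conj lam j)) (reverse (oneTo (part1 lam)))))

  𝒜-prefix-length : ∀ n lam w Ss Sp → In𝒜 n lam w (concat Ss ++ Sp) →
    ℓ w ≡ ℓ (w · concat Ss) + length (concat Ss) + 2 * sumN w Ss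
  𝒜-prefix-length n lam w Ss Sp ((perm , _) , T⊆Γ , chain) = begin
      ℓ w
    ≡⟨ chain-length n w (concat Ss) perm (++⁻ˡ (concat Ss) (All-resp-⊆ T⊆Γ (Γ-valid n lam)))
                    (DecChain-prefix w (concat Ss) Sp chain) ⟩
      ℓ (w · concat Ss) + length (concat Ss) + 2 * N w (concat Ss)
    ≡⟨ cong (λ m → ℓ (w · concat Ss) + length (concat Ss) + 2 * m) (sym (sumN≡N-concat w Ss)) ⟩
      ℓ (w · concat Ss) + length (concat Ss) + 2 * sumN w Ss
    ∎
    where open ≡-Reasoning

open Inversions using (𝒜-prefix-length)
open import Data.Integer using (+_; _+_; _-_; _*_)
open import Data.Integer.Properties using (pos-+; pos-*)
open import Data.Integer.Tactic.RingSolver using (solve-∀)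
open import Data.List.Properties using (length-++)
open import Relation.Binary.PropositionalEquality using (refl; cong₂; trans)
import Data.Nat as ℕ

-- The identity of the theorem, once ℓ(w) = ℓ(w′) + L + 2s and |T| = L + |S_p|.
rearrange : ∀ (ℓw′ ℓwT L Lp s : ℕ) →
  + (ℓw′ ℕ.+ L ℕ.+ 2 ℕ.* s) + + ℓwT - + (L ℕ.+ Lp) ≡ + ℓw′ + + ℓwT - + Lp + + 2 * + s
rearrange ℓw′ ℓwT L Lp s =
  trans (cong₂ (λ a b → a + + ℓwT - b)
               (trans (pos-+ (ℓw′ ℕ.+ L) (2 ℕ.* s)) (cong₂ _+_ (pos-+ ℓw′ L) (pos-* 2 s)))
               (pos-+ L Lp))
        (ring (+ ℓw′) (+ ℓwT) (+ L) (+ Lp) (+ s))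
  where
  ring : ∀ a b l lp m → a + l + + 2 * m + b - (l + lp) ≡ a + b - lp + + 2 * m
  ring = solve-∀

lemma5p1 : (n : ℕ) → 2 ≤ n → (λ′ : List ℕ) → IsPartition≤ n λ′ →
    (w : List ℕ) (T : List Transp) → In𝒜 n λ′ w T →
    (Ss : List (List Transp)) (Sp : List Transp) →
    All (λ S → ¬ (S ≡ [])) Ss → ¬ (Sp ≡ []) → concat Ss ++ Sp ≡ T →
    (+ ℓ w) + (+ ℓ (w · T)) - (+ length T)
      ≡ (+ ℓ (w · concat Ss)) + (+ ℓ (w · T)) - (+ length Sp) + (+ 2) * (+ sumN w Ss)
lemma5p1 n _ λ′ _ w .(concat Ss ++ Sp) wT∈𝒜 Ss Sp _ _ refl
  rewrite 𝒜-prefix-length n λ′ w Ss Sp wT∈𝒜 | length-++ (concat Ss) {Sp} =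
  rearrange (ℓ (w · concat Ss)) (ℓ (w · (concat Ss ++ Sp))) (length (concat Ss)) (length Sp) (sumN w Ss)
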